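{- Let $q$ be a prime, $n>1$ an integer dividing $q-1$, and $1<k<q$ an integer of multiplicative order $n$ modulo $q$. Let $G = G_{q,n} = \langle a,b \mid a^q = b^n = 1,\ b^{ -1}ab = a^k\rangle$. Let $C\to\mathbb{P}^1$ be a $G$-Galois cover branched at $3$ points with monodromy datum $(G,\bm{x})$. Then the local monodromy $\bm{m}$ is either a permutation of $(q,n,n)$, or a triple $(n_1,n_2,n_3)$ in which each $n_i$ divides $n$.
   Context: A monodromy datum $(G,\bm{x})$ consists of a finite group $G$ and a triple $\bm{x}=(x_1,x_2,x_3)$ of non-identity elements of $G$ with $x_1x_2x_3=1$ that generate $G$; the local monodromy is $\bm{m}=(m_1,m_2,m_3)$ with $m_i$ the order of $x_i$. A Galois cover of $\mathbb{P}^1$ branched at three points determines such a datum via its monodromy. -}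

module Defs where

open import Data.Nat using (ℕ; zero; suc; _+_; _*_; _^_; _<_; NonZero)
open import Data.Nat.DivMod using (_mod_)
open import Data.Fin using (Fin; toℕ)
open import Data.Product using (_×_; _,_)
open import Relation.Binary.PropositionalEquality using (_≡_; _≢_)

-- The metacyclic group G_{q,n} = < a, b | a^q = b^n = 1, b^{-1} a b = a^k >,
-- realised concretely as the set of normal forms  b^j a^i  (j mod n, i mod q).
-- Since b^{-j'} a^i b^{j'} = a^{i k^{j'}}, the product is
--   (b^j a^i)(b^{j'} a^{i'}) = b^{j+j'} a^{i k^{j'} + i'} .
module Metacyclic (q n k : ℕ) .{{_ : NonZero q}} .{{_ : NonZero n}} where

  G : Set
  G = Fin n × Fin q

  e : G
  e = (0 mod n , 0 mod q)

  _·_ : G → G → G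
  (j , i) · (j' , i') =
    ((toℕ j + toℕ j') mod n , (toℕ i * k ^ toℕ j' + toℕ i') mod q)

  a b : G
  a = (0 mod n , 1 mod q)
  b = (1 mod n , 0 mod q)

  _^ᴳ_ : G → ℕ → G
  x ^ᴳ zero = e
  x ^ᴳ suc m = x · (x ^ᴳ m)

  IsOrder : G → ℕ → Set
  IsOrder x m = (0 < m) × (x ^ᴳ m ≡ e) × (∀ m' → 0 < m' → m' < m → x ^ᴳ m' ≢ e)

  data Gen (x₁ x₂ x₃ : G) : G → Set where
    gen-e   : Gen x₁ x₂ x₃ e
    gen-1   : Gen x₁ x₂ x₃ x₁
    gen-2   : Gen x₁ x₂ x₃ x₂
    gen-3   : Gen x₁ x₂ x₃ x₃
    gen-mul : ∀ {y z} → Gen x₁ x₂ x₃ y → Gen x₁ x₂ x₃ z → Gen x₁ x₂ x₃ (y · z)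
    gen-inv : ∀ {y z} → Gen x₁ x₂ x₃ y → y · z ≡ e → Gen x₁ x₂ x₃ z

  IsMonodromyDatum : G → G → G → Set
  IsMonodromyDatum x₁ x₂ x₃ =
    (x₁ ≢ e) × (x₂ ≢ e) × (x₃ ≢ e) × ((x₁ · x₂) · x₃ ≡ e)
    × (∀ g → Gen x₁ x₂ x₃ g)

MultOrder : (k n q : ℕ) → .{{NonZero q}} → Set
MultOrder k n q = (k ^ n mod q ≡ 1 mod q)
                × (∀ m → 0 < m → m < n → k ^ m mod q ≢ 1 mod q)

-- An element b^j a^i of G maps to its exponent j in the quotient G/⟨a⟩ ≅ ℤ/n, and
-- x₁x₂x₃ = 1 generating G means that the three exponents sum to 0 mod n and generate ℤ/n.
-- Elements with j = 0 are non-trivial powers of a, hence of order q.  For j ≠ 0 the power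
-- (b^j a^i)^m is b^{mj} a^{i(1 + r + ⋯ + r^{m-1})} with r = k^j ≢ 1 (mod q), so it is trivial
-- exactly when n ∣ m j: the order is the order of j in ℤ/n, a divisor of n.  If one exponent
-- vanishes the other two are opposite and must generate ℤ/n, so both have order exactly n.
module Submission where

open import Defs
open import Data.Nat
open import Data.Nat.Properties
open import Data.Nat.DivMod
open import Data.Nat.Divisibility
open import Data.Nat.Primality using (Prime; euclidsLemma)
open import Data.Nat.Tactic.RingSolver using (solve-∀)
open import Data.Fin using (toℕ)
open import Data.Fin.Properties using (toℕ-injective; toℕ-fromℕ<; toℕ<n)
open import Data.Product using (_×_; _,_; proj₁; proj₂)
open import Data.Sum using (_⊎_; inj₁; inj₂)
open import Data.Empty using (⊥-elim)
open import Relation.Nullary using (¬_; yes; no)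
open import Relation.Binary.PropositionalEquality
open import Function using (_∘_)

toℕ-mod : ∀ m d .{{_ : NonZero d}} → toℕ (m mod d) ≡ m % d
toℕ-mod m d = toℕ-fromℕ< (m%n<n m d)

mod≡mod⇒%≡% : ∀ m m′ d .{{_ : NonZero d}} → m mod d ≡ m′ mod d → m % d ≡ m′ % d
mod≡mod⇒%≡% m m′ d h = trans (sym (toℕ-mod m d)) (trans (cong toℕ h) (toℕ-mod m′ d))

%≡%⇒mod≡mod : ∀ m m′ d .{{_ : NonZero d}} → m % d ≡ m′ % d → m mod d ≡ m′ mod d
%≡%⇒mod≡mod m m′ d h = toℕ-injective (trans (toℕ-mod m d) (trans h (sym (toℕ-mod m′ d))))

0%n≡0 : ∀ d .{{_ : NonZero d}} → 0 % d ≡ 0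
0%n≡0 d = m<n⇒m%n≡m (>-nonZero⁻¹ d)

%-cong-+ : ∀ {a a′ b b′} d .{{_ : NonZero d}} →
           a % d ≡ a′ % d → b % d ≡ b′ % d → (a + b) % d ≡ (a′ + b′) % d
%-cong-+ {a} {a′} {b} {b′} d p r = begin
  (a + b) % d               ≡⟨ %-distribˡ-+ a b d ⟩
  (a % d + b % d) % d       ≡⟨ cong₂ (λ u v → (u + v) % d) p r ⟩
  (a′ % d + b′ % d) % d     ≡⟨ %-distribˡ-+ a′ b′ d ⟨
  (a′ + b′) % d             ∎
  where open ≡-Reasoning

%-cong-* : ∀ {a a′ b b′} d .{{_ : NonZero d}} →
           a % d ≡ a′ % d → b % d ≡ b′ % d → (a * b) % d ≡ (a′ * b′) % d
%-cong-* {a} {a′} {b} {b′} d p r = begin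
  (a * b) % d               ≡⟨ %-distribˡ-* a b d ⟩
  (a % d * (b % d)) % d     ≡⟨ cong₂ (λ u v → (u * v) % d) p r ⟩
  (a′ % d * (b′ % d)) % d   ≡⟨ %-distribˡ-* a′ b′ d ⟨
  (a′ * b′) % d             ∎
  where open ≡-Reasoning

[m+n]%d≡n%d⇒d∣m : ∀ m n d .{{_ : NonZero d}} → (m + n) % d ≡ n % d → d ∣ m
[m+n]%d≡n%d⇒d∣m m n d h = divides t (+-cancelˡ-≡ r m (t * d) (begin
  r + m                 ≡⟨ +-comm r m ⟩
  m + r                 ≡⟨ m≡m%n+[m/n]*n (m + r) d ⟩
  (m + r) % d + t * d   ≡⟨ cong (_+ t * d) m+r≡r ⟩
  r + t * d             ∎))
  where
  open ≡-Reasoning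
  r t : ℕ
  r = n % d
  t = (m + r) / d
  m+r≡r : (m + r) % d ≡ r
  m+r≡r = trans (%-cong-+ {a = m} d refl (m%n%n≡m%n n d)) h

d∣m⇒d∣c*[m%d] : ∀ c m d .{{_ : NonZero d}} → d ∣ c * m → d ∣ c * (m % d)
d∣m⇒d∣c*[m%d] c m d h =
  m%n≡0⇒n∣m _ d (trans (%-cong-* {a = c} d refl (m%n%n≡m%n m d)) (n∣m⇒m%n≡0 _ d h))

∣-opposite : ∀ {n a b} d → n ∣ a + b → n ∣ d * a → n ∣ d * b
∣-opposite {n} {a} {b} d n∣a+b n∣da =
  ∣m+n∣m⇒∣n (subst (n ∣_) (*-distribˡ-+ d a b) (∣n⇒∣m*n d n∣a+b)) n∣da

^-%-period : ∀ {k n q} .{{_ : NonZero n}} .{{_ : NonZero q}} →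
             k ^ n % q ≡ 1 % q → ∀ a → k ^ (a % n) % q ≡ k ^ a % q
^-%-period {k} {n} {q} kⁿ≡1 a = begin
  k ^ (a % n) % q                         ≡⟨ cong (_% q) (*-identityʳ _) ⟨
  (k ^ (a % n) * 1) % q                   ≡⟨ %-cong-* {a = k ^ (a % n)} q refl (kⁿᶜ≡1 (a / n)) ⟨
  (k ^ (a % n) * (k ^ n) ^ (a / n)) % q   ≡⟨ cong (λ u → (k ^ (a % n) * u) % q) (^-*-assoc k n (a / n)) ⟩
  (k ^ (a % n) * k ^ (n * (a / n))) % q   ≡⟨ cong (_% q) (^-distribˡ-+-* k (a % n) (n * (a / n))) ⟨
  k ^ (a % n + n * (a / n)) % q           ≡⟨ cong (λ u → k ^ (a % n + u) % q) (*-comm n (a / n)) ⟩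
  k ^ (a % n + a / n * n) % q             ≡⟨ cong (λ u → k ^ u % q) (m≡m%n+[m/n]*n a n) ⟨
  k ^ a % q                               ∎
  where
  open ≡-Reasoning
  kⁿᶜ≡1 : ∀ c → (k ^ n) ^ c % q ≡ 1 % q
  kⁿᶜ≡1 zero    = refl
  kⁿᶜ≡1 (suc c) = %-cong-* q kⁿ≡1 (kⁿᶜ≡1 c)

least-multiple-divides : ∀ {n j m} → 0 < m → n ∣ m * j →
                         (∀ r → 0 < r → r < m → ¬ (n ∣ r * j)) → m ∣ n
least-multiple-divides {n} {j} {m} 0<m n∣mj minimal = m%n≡0⇒n∣m n m n%m≡0
  where
  instance
    m≢0 : NonZero m
    m≢0 = >-nonZero 0<m
  split : ∀ r t m j → (r + t * m) * j ≡ t * (m * j) + r * j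
  split = solve-∀
  n∣[n%m]j : n ∣ n % m * j
  n∣[n%m]j = ∣m+n∣m⇒∣n
    (subst (n ∣_) (trans (cong (_* j) (m≡m%n+[m/n]*n n m)) (split (n % m) (n / m) m j)) (m∣m*n j))
    (∣n⇒∣m*n (n / m) n∣mj)
  n%m≡0 : n % m ≡ 0
  n%m≡0 with n % m ≟ 0
  ... | yes n%m≡0 = n%m≡0
  ... | no  n%m≢0 = ⊥-elim (minimal (n % m) (n≢0⇒n>0 n%m≢0) (m%n<n n m) n∣[n%m]j)

geometric : ℕ → ℕ → ℕ
geometric r zero    = 0
geometric r (suc m) = r ^ m + geometric r m

geometric-1 : ∀ m → geometric 1 m ≡ m
geometric-1 zero    = refl
geometric-1 (suc m) = cong₂ _+_ (^-zeroˡ m) (geometric-1 m)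

r*geometric+1 : ∀ r m → r * geometric r m + 1 ≡ geometric r m + r ^ m
r*geometric+1 r zero    = cong (_+ 1) (*-zeroʳ r)
r*geometric+1 r (suc m) = begin
  r * (r ^ m + s) + 1         ≡⟨ expand r (r ^ m) s ⟩
  r * r ^ m + (r * s + 1)     ≡⟨ cong (r * r ^ m +_) (r*geometric+1 r m) ⟩
  r * r ^ m + (s + r ^ m)     ≡⟨ regroup (r * r ^ m) s (r ^ m) ⟩
  (r ^ m + s) + r * r ^ m     ∎
  where
  open ≡-Reasoning
  s : ℕ
  s = geometric r m
  expand : ∀ r p s → r * (p + s) + 1 ≡ r * p + (r * s + 1)
  expand = solve-∀
  regroup : ∀ u s p → u + (s + p) ≡ (p + s) + u
  regroup = solve-∀

-- (r − 1)(1 + r + ⋯ + r^{m−1}) = r^m − 1, and q is prime and does not divide r − 1.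
prime∣geometric : ∀ {q r m} .{{_ : NonZero q}} .{{_ : NonZero r}} → Prime q →
                  r % q ≢ 1 % q → r ^ m % q ≡ 1 % q → q ∣ geometric r m
prime∣geometric {q} {r} {m} q-prime r≢1 rᵐ≡1
  with euclidsLemma (pred r) s q-prime (q∣[r-1]s)
  where
  open ≡-Reasoning
  s : ℕ
  s = geometric r m
  regroup : ∀ d s → suc d * s + 1 ≡ d * s + (s + 1)
  regroup = solve-∀
  q∣[r-1]s : q ∣ pred r * s
  q∣[r-1]s = [m+n]%d≡n%d⇒d∣m _ _ q (begin
    (pred r * s + (s + 1)) % q   ≡⟨ cong (_% q) (regroup (pred r) s) ⟨
    (suc (pred r) * s + 1) % q   ≡⟨ cong (λ u → (u * s + 1) % q) (suc-pred r) ⟩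
    (r * s + 1) % q              ≡⟨ cong (_% q) (r*geometric+1 r m) ⟩
    (s + r ^ m) % q              ≡⟨ %-cong-+ {a = s} q refl rᵐ≡1 ⟩
    (s + 1) % q                  ∎)
... | inj₂ q∣s   = q∣s
... | inj₁ q∣r-1 = ⊥-elim (r≢1 (trans (cong (_% q) (sym (suc-pred r))) (%-remove-+ʳ 1 q∣r-1)))

module Exponents (q n k : ℕ) .{{_ : NonZero q}} .{{_ : NonZero n}} where
  open Metacyclic q n k

  π ρ : G → ℕ
  π x = toℕ (proj₁ x)
  ρ x = toℕ (proj₂ x)

  π-e : π e ≡ 0
  π-e = trans (toℕ-mod 0 n) (0%n≡0 n)

  ρ-e : ρ e ≡ 0
  ρ-e = trans (toℕ-mod 0 q) (0%n≡0 q)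

  π≡0∧ρ≡0⇒≡e : ∀ x → π x ≡ 0 → ρ x ≡ 0 → x ≡ e
  π≡0∧ρ≡0⇒≡e (j , i) πx≡0 ρx≡0 =
    cong₂ _,_ (toℕ-injective (trans πx≡0 (sym π-e))) (toℕ-injective (trans ρx≡0 (sym ρ-e)))

  π-· : ∀ x y → π (x · y) ≡ (π x + π y) % n
  π-· x y = toℕ-mod _ n

  π-^ : ∀ x m → π (x ^ᴳ m) ≡ m * π x % n
  π-^ x zero    = toℕ-mod 0 n
  π-^ x (suc m) = begin
    π (x · (x ^ᴳ m))             ≡⟨ π-· x (x ^ᴳ m) ⟩
    (π x + π (x ^ᴳ m)) % n       ≡⟨ %-cong-+ {a = π x} n refl (trans (cong (_% n) (π-^ x m)) (m%n%n≡m%n _ n)) ⟩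
    (π x + m * π x) % n          ∎
    where open ≡-Reasoning

  ^ᴳ≡e⇒n∣m*π : ∀ x m → x ^ᴳ m ≡ e → n ∣ m * π x
  ^ᴳ≡e⇒n∣m*π x m xᵐ≡e = m%n≡0⇒n∣m _ n (trans (sym (π-^ x m)) (trans (cong π xᵐ≡e) π-e))

  ρ-^ : k ^ n % q ≡ 1 % q → ∀ x m → ρ (x ^ᴳ m) ≡ ρ x * geometric (k ^ π x) m % q
  ρ-^ kⁿ≡1 x zero    = trans (toℕ-mod 0 q) (cong (_% q) (sym (*-zeroʳ (ρ x))))
  ρ-^ kⁿ≡1 x (suc m) = begin
    ρ (x · (x ^ᴳ m))                              ≡⟨ toℕ-mod _ q ⟩
    (i * k ^ π (x ^ᴳ m) + ρ (x ^ᴳ m)) % q         ≡⟨ cong₂ (λ u v → (i * k ^ u + v) % q) (π-^ x m) (ρ-^ kⁿ≡1 x m) ⟩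
    (i * k ^ (m * j % n) + i * s % q) % q         ≡⟨ %-cong-+ q (%-cong-* {a = i} q refl (^-%-period kⁿ≡1 (m * j)))
                                                                 (m%n%n≡m%n (i * s) q) ⟩
    (i * k ^ (m * j) + i * s) % q                 ≡⟨ cong (λ u → (i * k ^ u + i * s) % q) (*-comm m j) ⟩
    (i * k ^ (j * m) + i * s) % q                 ≡⟨ cong (λ u → (i * u + i * s) % q) (^-*-assoc k j m) ⟨
    (i * (k ^ j) ^ m + i * s) % q                 ≡⟨ cong (_% q) (*-distribˡ-+ i ((k ^ j) ^ m) s) ⟨
    i * geometric (k ^ j) (suc m) % q             ∎
    where
    open ≡-Reasoning
    i j s : ℕ
    i = ρ x
    j = π x
    s = geometric (k ^ j) m

  -- d kills the image of x in G/⟨a⟩ ≅ ℤ/n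
  Annihilates : ℕ → G → Set
  Annihilates d x = n ∣ d * π x

  annihilates-· : ∀ d x y → Annihilates d x → Annihilates d y → Annihilates d (x · y)
  annihilates-· d x y dx dy = subst (n ∣_) (cong (d *_) (sym (π-· x y)))
    (d∣m⇒d∣c*[m%d] d (π x + π y) n
      (subst (n ∣_) (sym (*-distribˡ-+ d (π x) (π y))) (∣m∣n⇒∣m+n dx dy)))

  annihilates-inverse : ∀ d x y → x · y ≡ e → Annihilates d x → Annihilates d y
  annihilates-inverse d x y xy≡e =
    ∣-opposite d (m%n≡0⇒n∣m _ n (trans (sym (π-· x y)) (trans (cong π xy≡e) π-e)))

  annihilates-zero : ∀ d x → π x ≡ 0 → Annihilates d x
  annihilates-zero d x πx≡0 =
    subst (λ u → n ∣ d * u) (sym πx≡0) (subst (n ∣_) (sym (*-zeroʳ d)) (n ∣0))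

  annihilates-Gen : ∀ d {x₁ x₂ x₃} → Annihilates d x₁ → Annihilates d x₂ → Annihilates d x₃ →
                    ∀ {g} → Gen x₁ x₂ x₃ g → Annihilates d g
  annihilates-Gen d d₁ d₂ d₃ gen-e                      = annihilates-zero d e π-e
  annihilates-Gen d d₁ d₂ d₃ gen-1                      = d₁
  annihilates-Gen d d₁ d₂ d₃ gen-2                      = d₂
  annihilates-Gen d d₁ d₂ d₃ gen-3                      = d₃
  annihilates-Gen d d₁ d₂ d₃ (gen-mul {y} {z} gy gz)    =
    annihilates-· d y z (annihilates-Gen d d₁ d₂ d₃ gy) (annihilates-Gen d d₁ d₂ d₃ gz)
  annihilates-Gen d d₁ d₂ d₃ (gen-inv {y} {z} gy yz≡e)  =
    annihilates-inverse d y z yz≡e (annihilates-Gen d d₁ d₂ d₃ gy)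

  ExponentsGenerate : G → G → G → Set
  ExponentsGenerate x₁ x₂ x₃ = ∀ d → Annihilates d x₁ → Annihilates d x₂ → Annihilates d x₃ → n ∣ d

  generating⇒ExponentsGenerate : 1 < n → ∀ {x₁ x₂ x₃} → (∀ g → Gen x₁ x₂ x₃ g) → ExponentsGenerate x₁ x₂ x₃
  generating⇒ExponentsGenerate 1<n generating d d₁ d₂ d₃ =
    subst (n ∣_) (trans (cong (d *_) π-b) (*-identityʳ d)) (annihilates-Gen d d₁ d₂ d₃ (generating b))
    where
    π-b : π b ≡ 1
    π-b = trans (toℕ-mod 1 n) (m<n⇒m%n≡m 1<n)

  product≡e⇒n∣π-sum : ∀ x₁ x₂ x₃ → (x₁ · x₂) · x₃ ≡ e → n ∣ π x₁ + π x₂ + π x₃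
  product≡e⇒n∣π-sum x₁ x₂ x₃ x₁x₂x₃≡e = m%n≡0⇒n∣m _ n (begin
    (π x₁ + π x₂ + π x₃) % n            ≡⟨ %-cong-+ {b = π x₃} n (m%n%n≡m%n _ n) refl ⟨
    ((π x₁ + π x₂) % n + π x₃) % n      ≡⟨ cong (λ u → (u + π x₃) % n) (π-· x₁ x₂) ⟨
    (π (x₁ · x₂) + π x₃) % n            ≡⟨ π-· (x₁ · x₂) x₃ ⟨
    π ((x₁ · x₂) · x₃)                  ≡⟨ cong π x₁x₂x₃≡e ⟩
    π e                                 ≡⟨ π-e ⟩
    0                                   ∎)
    where open ≡-Reasoning

module Orders (q n k : ℕ) .{{_ : NonZero q}} .{{_ : NonZero n}}
              (q-prime : Prime q) (1<n : 1 < n) (0<k : 0 < k) (k-order : MultOrder k n q) where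
  open Metacyclic q n k
  open Exponents q n k

  instance
    k≢0 : NonZero k
    k≢0 = >-nonZero 0<k

  kⁿ≡1 : k ^ n % q ≡ 1 % q
  kⁿ≡1 = mod≡mod⇒%≡% (k ^ n) 1 q (proj₁ k-order)

  order-in-kernel : ∀ {x m} → π x ≡ 0 → x ≢ e → IsOrder x m → m ≡ q
  order-in-kernel {x} {m} πx≡0 x≢e (0<m , xᵐ≡e , minimal) = ≤-antisym m≤q q≤m
    where
    π-xᵗ : ∀ t → π (x ^ᴳ t) ≡ 0
    π-xᵗ t = trans (π-^ x t) (trans (cong (λ u → t * u % n) πx≡0) (trans (cong (_% n) (*-zeroʳ t)) (0%n≡0 n)))
    ρ-xᵗ : ∀ t → ρ (x ^ᴳ t) ≡ ρ x * t % q
    ρ-xᵗ t = trans (ρ-^ kⁿ≡1 x t)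
      (cong (λ u → ρ x * u % q) (trans (cong (λ u → geometric (k ^ u) t) πx≡0) (geometric-1 t)))
    m≤q : m ≤ q
    m≤q = ≮⇒≥ λ q<m → minimal q (>-nonZero⁻¹ q) q<m
      (π≡0∧ρ≡0⇒≡e _ (π-xᵗ q) (trans (ρ-xᵗ q) (m*n%n≡0 (ρ x) q)))
    q≤m : q ≤ m
    q≤m with euclidsLemma (ρ x) m q-prime (m%n≡0⇒n∣m _ q (trans (sym (ρ-xᵗ m)) (trans (cong ρ xᵐ≡e) ρ-e)))
    ... | inj₂ q∣m  = ∣⇒≤ {{>-nonZero 0<m}} q∣m
    ... | inj₁ q∣ρx = ⊥-elim (<⇒≱ (toℕ<n (proj₂ x)) (∣⇒≤ {{≢-nonZero ρx≢0}} q∣ρx))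
      where
      ρx≢0 : ρ x ≢ 0
      ρx≢0 = x≢e ∘ π≡0∧ρ≡0⇒≡e x πx≡0

  n∣m*π⇒^ᴳ≡e : ∀ {x m} → π x ≢ 0 → n ∣ m * π x → x ^ᴳ m ≡ e
  n∣m*π⇒^ᴳ≡e {x} {m} πx≢0 n∣mj =
    π≡0∧ρ≡0⇒≡e _ (trans (π-^ x m) (n∣m⇒m%n≡0 _ n n∣mj))
                 (trans (ρ-^ kⁿ≡1 x m) (n∣m⇒m%n≡0 _ q (∣n⇒∣m*n (ρ x) q∣geometric)))
    where
    open ≡-Reasoning
    j : ℕ
    j = π x
    instance
      kʲ≢0 : NonZero (k ^ j)
      kʲ≢0 = m^n≢0 k j
    kʲ≢1 : k ^ j % q ≢ 1 % q
    kʲ≢1 = proj₂ k-order j (n≢0⇒n>0 πx≢0) (toℕ<n (proj₁ x)) ∘ %≡%⇒mod≡mod (k ^ j) 1 q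
    kʲᵐ≡1 : (k ^ j) ^ m % q ≡ 1 % q
    kʲᵐ≡1 = begin
      (k ^ j) ^ m % q     ≡⟨ cong (_% q) (trans (^-*-assoc k j m) (cong (k ^_) (*-comm j m))) ⟩
      k ^ (m * j) % q     ≡⟨ ^-%-period kⁿ≡1 (m * j) ⟨
      k ^ (m * j % n) % q ≡⟨ cong (λ u → k ^ u % q) (n∣m⇒m%n≡0 _ n n∣mj) ⟩
      1 % q               ∎
    q∣geometric : q ∣ geometric (k ^ j) m
    q∣geometric = prime∣geometric {m = m} q-prime kʲ≢1 kʲᵐ≡1

  order-outside-kernel : ∀ {x m} → π x ≢ 0 → IsOrder x m → n ∣ m * π x × m ∣ n
  order-outside-kernel {x} {m} πx≢0 (0<m , xᵐ≡e , minimal) =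
    n∣mj , least-multiple-divides 0<m n∣mj λ r 0<r r<m → minimal r 0<r r<m ∘ n∣m*π⇒^ᴳ≡e πx≢0
    where
    n∣mj : n ∣ m * π x
    n∣mj = ^ᴳ≡e⇒n∣m*π x m xᵐ≡e

  order-in-generating-pair : ∀ {y m c} → n ∣ π y + c →
                             (∀ d → n ∣ d * π y → n ∣ d * c → n ∣ d) → IsOrder y m → m ≡ n
  order-in-generating-pair {y} {m} n∣πy+c generates y-order with π y ≟ 0
  ... | yes πy≡0 = ⊥-elim (<⇒≱ 1<n (∣⇒≤ (generates 1 d₁ (∣-opposite 1 n∣πy+c d₁))))
    where
    d₁ : Annihilates 1 y
    d₁ = annihilates-zero 1 y πy≡0
  ... | no πy≢0 =
    let n∣mπy , m∣n = order-outside-kernel πy≢0 y-order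
    in ∣-antisym m∣n (generates m n∣mπy (∣-opposite m n∣πy+c n∣mπy))

  orders-with-kernel-element : ∀ {x y z mx my mz} → n ∣ π x + π y + π z → ExponentsGenerate x y z →
                               π x ≡ 0 → x ≢ e → IsOrder x mx → IsOrder y my → IsOrder z mz →
                               mx ≡ q × my ≡ n × mz ≡ n
  orders-with-kernel-element {x} {y} {z} sum generates πx≡0 x≢e x-order y-order z-order =
    order-in-kernel πx≡0 x≢e x-order ,
    order-in-generating-pair n∣πy+πz generates′ y-order ,
    order-in-generating-pair (subst (n ∣_) (+-comm (π y) (π z)) n∣πy+πz) (λ d dz dy → generates′ d dy dz) z-order
    where
    n∣πy+πz : n ∣ π y + π z
    n∣πy+πz = subst (λ u → n ∣ u + π y + π z) πx≡0 sum
    generates′ : ∀ d → Annihilates d y → Annihilates d z → n ∣ d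
    generates′ d = generates d (annihilates-zero d x πx≡0)

  orders-of-exponent-triple : ∀ {x₁ x₂ x₃ m₁ m₂ m₃} →
    n ∣ π x₁ + π x₂ + π x₃ → ExponentsGenerate x₁ x₂ x₃ → x₁ ≢ e → x₂ ≢ e → x₃ ≢ e →
    IsOrder x₁ m₁ → IsOrder x₂ m₂ → IsOrder x₃ m₃ →
    ((m₁ ≡ q × m₂ ≡ n × m₃ ≡ n) ⊎ (m₁ ≡ n × m₂ ≡ q × m₃ ≡ n) ⊎ (m₁ ≡ n × m₂ ≡ n × m₃ ≡ q))
    ⊎ (m₁ ∣ n × m₂ ∣ n × m₃ ∣ n)
  orders-of-exponent-triple {x₁} {x₂} {x₃} sum generate x₁≢e x₂≢e x₃≢e o₁ o₂ o₃
    with π x₁ ≟ 0 | π x₂ ≟ 0 | π x₃ ≟ 0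
  ... | yes πx₁≡0 | _ | _ =
    inj₁ (inj₁ (orders-with-kernel-element sum generate πx₁≡0 x₁≢e o₁ o₂ o₃))
  ... | no _ | yes πx₂≡0 | _ =
    let m₂≡q , m₁≡n , m₃≡n = orders-with-kernel-element
          (subst (n ∣_) (cong (_+ π x₃) (+-comm (π x₁) (π x₂))) sum)
          (λ d d₂ d₁ d₃ → generate d d₁ d₂ d₃) πx₂≡0 x₂≢e o₂ o₁ o₃
    in inj₁ (inj₂ (inj₁ (m₁≡n , m₂≡q , m₃≡n)))
  ... | no _ | no _ | yes πx₃≡0 =
    let m₃≡q , m₁≡n , m₂≡n = orders-with-kernel-element
          (subst (n ∣_) (trans (+-comm (π x₁ + π x₂) (π x₃)) (sym (+-assoc (π x₃) (π x₁) (π x₂)))) sum)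
          (λ d d₃ d₁ d₂ → generate d d₁ d₂ d₃) πx₃≡0 x₃≢e o₃ o₁ o₂
    in inj₁ (inj₂ (inj₂ (m₁≡n , m₂≡n , m₃≡q)))
  ... | no πx₁≢0 | no πx₂≢0 | no πx₃≢0 =
    inj₂ (proj₂ (order-outside-kernel πx₁≢0 o₁) ,
          proj₂ (order-outside-kernel πx₂≢0 o₂) ,
          proj₂ (order-outside-kernel πx₃≢0 o₃))

-- The hypotheses n ∣ q − 1 and k < q only serve to make such a k exist.
proposition4p1 : (q n k : ℕ) → .{{_ : NonZero q}} → .{{_ : NonZero n}}
    → Prime q → 1 < n → n ∣ q ∸ 1 → 1 < k → k < q → MultOrder k n q
    → (x₁ x₂ x₃ : Metacyclic.G q n k) → Metacyclic.IsMonodromyDatum q n k x₁ x₂ x₃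
    → (m₁ m₂ m₃ : ℕ)
    → Metacyclic.IsOrder q n k x₁ m₁ → Metacyclic.IsOrder q n k x₂ m₂ → Metacyclic.IsOrder q n k x₃ m₃
    → ((m₁ ≡ q × m₂ ≡ n × m₃ ≡ n) ⊎ (m₁ ≡ n × m₂ ≡ q × m₃ ≡ n) ⊎ (m₁ ≡ n × m₂ ≡ n × m₃ ≡ q))
      ⊎ (m₁ ∣ n × m₂ ∣ n × m₃ ∣ n)
proposition4p1 q n k q-prime 1<n _ 1<k _ k-order x₁ x₂ x₃
               (x₁≢e , x₂≢e , x₃≢e , x₁x₂x₃≡e , generating) _ _ _ =
  orders-of-exponent-triple
    (product≡e⇒n∣π-sum x₁ x₂ x₃ x₁x₂x₃≡e) (generating⇒ExponentsGenerate 1<n generating)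
    x₁≢e x₂≢e x₃≢e
  where
  open Exponents q n k
  open Orders q n k q-prime 1<n (<-trans z<s 1<k) k-order
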